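{- Let $b\ge1$, $\tau\in\{\tau_{\mathbb{Z}PT}^b,\tau_{\mathbb{Z}PPT}^b,\tau_{R\mathbb{Z}PT}^b\}$ and let $(sup,sig)$ be a $\tau$-region of a TS $A=(S,E,\delta,\iota)$. Define $abs:E\to\{0,\dots,b\}$ by $abs(e)=(-m+n)\bmod(b+1)$ if $sig(e)=(m,n)$, and $abs(e)=sig(e)$ if $sig(e)\in\{0,\dots,b\}$. Then $(sup,abs)$ is an abstract $\tau$-region of $A$.
   Context: A TS is $A=(S,E,\delta,\iota)$ with finite $S,E$, partial $\delta:S\times E\to S$, initial state $\iota$ from which all states are reachable. All three types have $S_\tau=\{0,\dots,b\}$, $E_\tau=(\{0,\dots,b\}^2\setminus\{(0,0)\})\cup\{0,\dots,b\}$ (integers distinct from pairs) and $\delta_\tau(s,x)=(s+x)\bmod(b+1)$ for $x\in\{0,\dots,b\}$; in $\tau_{\mathbb{Z}PT}^b$, $\delta_\tau(s,(m,n))=s-m+n$ if $s\ge m$ and $s-m+n\le b$ (else undefined); $\tau_{\mathbb{Z}PPT}^b$ is $\tau_{\mathbb{Z}PT}^b$ without events $(m,n)$ with $1\le m,n\le b$; in $\tau_{R\mathbb{Z}PT}^b$, $\delta_\tau(s,(m,n))=n$ if $s=m$, undefined otherwise. A $\tau$-region is $(sup,sig)$ with $sup:S\to S_\tau$, $sig:E\to E_\tau$ and $\delta_\tau(sup(s),sig(e))=sup(s')$ for all edges $s\xrightarrow{e}s'$. An abstract $\tau$-region is a $\tau$-region whose signature takes values in $\{0,\dots,b\}$.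 -}

module Defs where

open import Data.Nat using (ℕ; zero; suc; _+_; _∸_; _≤_; _≤?_; _%_)
open import Data.Nat.DivMod using (m%n<n)
open import Data.Fin using (Fin; toℕ; fromℕ<)
open import Data.Fin.Properties using () renaming (_≟_ to _≟ᶠ_)
open import Data.Maybe using (Maybe; just; nothing)
open import Data.Product using (Σ; _×_; _,_; proj₁)
open import Data.Sum using (_⊎_)
open import Data.Unit using (⊤)
open import Relation.Nullary using (¬_; yes; no)
open import Relation.Binary.PropositionalEquality using (_≡_)

record TS : Set where
  field
    nS nE : ℕ
    δ     : Fin nS → Fin nE → Maybe (Fin nS)
    ι     : Fin nS

module _ (A : TS) where
  open TS A
  data Reachable : Fin nS → Set where
    init : Reachable ι
    step : ∀ {s s'} (e : Fin nE) → Reachable s → δ s e ≡ just s' → Reachable s'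

-- a TS in the sense of the paper: every state is reachable from ι
AllReachable : TS → Set
AllReachable A = ∀ s → Reachable A s

data Kind : Set where
  ZPT ZPPT RZPT : Kind

data RawEv (b : ℕ) : Set where
  num  : Fin (suc b) → RawEv b
  pair : Fin (suc b) → Fin (suc b) → RawEv b

ValidEv : Kind → (b : ℕ) → RawEv b → Set
ValidEv k    b (num x)    = ⊤
ValidEv ZPT  b (pair m n) = ¬ (toℕ m ≡ 0 × toℕ n ≡ 0)
ValidEv ZPPT b (pair m n) = ¬ (toℕ m ≡ 0 × toℕ n ≡ 0) × (toℕ m ≡ 0 ⊎ toℕ n ≡ 0)
ValidEv RZPT b (pair m n) = ¬ (toℕ m ≡ 0 × toℕ n ≡ 0)

Eτ : Kind → ℕ → Set
Eτ k b = Σ (RawEv b) (ValidEv k b)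

addMod : (b : ℕ) → Fin (suc b) → Fin (suc b) → Fin (suc b)
addMod b s x = fromℕ< (m%n<n (toℕ s + toℕ x) (suc b))

δτ-raw : Kind → (b : ℕ) → Fin (suc b) → RawEv b → Maybe (Fin (suc b))
δτ-raw k b s (num x) = just (addMod b s x)
δτ-raw RZPT b s (pair m n) with s ≟ᶠ m
... | yes _ = just n
... | no  _ = nothing
δτ-raw ZPT  b s (pair m n) = ptStep b s m n
  where
  ptStep : (b : ℕ) → Fin (suc b) → Fin (suc b) → Fin (suc b) → Maybe (Fin (suc b))
  ptStep b s m n with toℕ m ≤? toℕ s | toℕ s ∸ toℕ m + toℕ n ≤? b
  ... | yes _ | yes p = just (fromℕ< {toℕ s ∸ toℕ m + toℕ n} (Data.Nat.s≤s p))
  ... | _     | _     = nothing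
δτ-raw ZPPT b s (pair m n) = δτ-raw ZPT b s (pair m n)

δτ : (k : Kind) (b : ℕ) → Fin (suc b) → Eτ k b → Maybe (Fin (suc b))
δτ k b s e = δτ-raw k b s (proj₁ e)

IsRegion : (k : Kind) (b : ℕ) (A : TS) →
           (Fin (TS.nS A) → Fin (suc b)) → (Fin (TS.nE A) → Eτ k b) → Set
IsRegion k b A sup sig =
  ∀ (s : Fin (TS.nS A)) (e : Fin (TS.nE A)) (s' : Fin (TS.nS A)) →
  TS.δ A s e ≡ just s' → δτ k b (sup s) (sig e) ≡ just (sup s')

numEv : (k : Kind) (b : ℕ) → Fin (suc b) → Eτ k b
numEv k b x = num x , _

IsAbstractRegion : (k : Kind) (b : ℕ) (A : TS) →
           (Fin (TS.nS A) → Fin (suc b)) → (Fin (TS.nE A) → Fin (suc b)) → Set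
IsAbstractRegion k b A sup sig = IsRegion k b A sup (λ e → numEv k b (sig e))

absEv : (k : Kind) (b : ℕ) → Eτ k b → Fin (suc b)
absEv k b (num x , _)    = x
absEv k b (pair m n , _) =
  fromℕ< (m%n<n (toℕ n + (suc b ∸ toℕ m)) (suc b))

-- A defined pair transition s —(m,n)→ s' of any of the three types satisfies m ≤ s and
-- s' = s − m + n (for the replacement type because s = m and s' = n).  Since s' ≤ b,
-- adding the residue of −m + n to s modulo b + 1 therefore lands exactly on s'.
module Submission where

open import Defs
open import Data.Nat using (ℕ; suc; _≤_; _+_; _∸_; _%_; _≤?_; s≤s; NonZero)
open import Data.Nat.Properties using (≤-refl; <⇒≤; m∸n+n≡m; n∸n≡0)
open import Data.Nat.DivMod using (m%n%n≡m%n; %-distribˡ-+; [m+n]%n≡m%n; m<n⇒m%n≡m)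
open import Data.Nat.Solver using (module +-*-Solver)
open import Data.Fin using (Fin; toℕ; fromℕ<)
open import Data.Fin.Properties using (toℕ-fromℕ<; toℕ-injective; toℕ<n) renaming (_≟_ to _≟ᶠ_)
open import Data.Maybe using (just)
open import Data.Product using (_×_; _,_)
open import Relation.Nullary using (yes; no)
open import Relation.Binary.PropositionalEquality
open ≡-Reasoning

[m+n%d]%d≡[m+n]%d : ∀ m n d .{{_ : NonZero d}} → (m + n % d) % d ≡ (m + n) % d
[m+n%d]%d≡[m+n]%d m n d = begin
  (m + n % d) % d           ≡⟨ %-distribˡ-+ m (n % d) d ⟩
  (m % d + n % d % d) % d   ≡⟨ cong (λ r → (m % d + r) % d) (m%n%n≡m%n n d) ⟩
  (m % d + n % d) % d       ≡⟨ %-distribˡ-+ m n d ⟨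
  (m + n) % d               ∎

-- d ∸ m is the natural-number representative of −m modulo d.
m≤s⇒[s+[n+[d∸m]]]%d≡[s∸m+n]%d : ∀ {s m} n d .{{_ : NonZero d}} → m ≤ s → m ≤ d →
                                 (s + (n + (d ∸ m))) % d ≡ (s ∸ m + n) % d
m≤s⇒[s+[n+[d∸m]]]%d≡[s∸m+n]%d {s} {m} n d m≤s m≤d = begin
  (s + (n + (d ∸ m))) % d               ≡⟨ cong (λ t → (t + (n + (d ∸ m))) % d) (m∸n+n≡m m≤s) ⟨
  ((s ∸ m + m) + (n + (d ∸ m))) % d     ≡⟨ cong (_% d) (regroup (s ∸ m) m n (d ∸ m)) ⟩
  ((s ∸ m + n) + (d ∸ m + m)) % d       ≡⟨ cong (λ t → ((s ∸ m + n) + t) % d) (m∸n+n≡m m≤d) ⟩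
  ((s ∸ m + n) + d) % d                 ≡⟨ [m+n]%n≡m%n (s ∸ m + n) d ⟩
  (s ∸ m + n) % d                       ∎
  where
  open +-*-Solver
  regroup : ∀ a m n c → (a + m) + (n + c) ≡ (a + n) + (c + m)
  regroup = solve 4 (λ a m n c → (a :+ m) :+ (n :+ c) := (a :+ n) :+ (c :+ m)) refl

pair-step⇒m≤s×s'≡s∸m+n : ∀ k b {s m n s'} → δτ-raw k b s (pair m n) ≡ just s' →
                          toℕ m ≤ toℕ s × toℕ s' ≡ toℕ s ∸ toℕ m + toℕ n
pair-step⇒m≤s×s'≡s∸m+n ZPT b {s} {m} {n} fires
  with toℕ m ≤? toℕ s | toℕ s ∸ toℕ m + toℕ n ≤? b
pair-step⇒m≤s×s'≡s∸m+n ZPT b refl | yes m≤s | yes s∸m+n≤b = m≤s , toℕ-fromℕ< (s≤s s∸m+n≤b)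
pair-step⇒m≤s×s'≡s∸m+n ZPT b ()   | yes _   | no _
pair-step⇒m≤s×s'≡s∸m+n ZPT b ()   | no _    | _
pair-step⇒m≤s×s'≡s∸m+n ZPPT b fires = pair-step⇒m≤s×s'≡s∸m+n ZPT b fires
pair-step⇒m≤s×s'≡s∸m+n RZPT b {s} {m} fires with s ≟ᶠ m
pair-step⇒m≤s×s'≡s∸m+n RZPT b {s} {n = n} refl | yes refl =
  ≤-refl , sym (cong (_+ toℕ n) (n∸n≡0 (toℕ s)))
pair-step⇒m≤s×s'≡s∸m+n RZPT b ()   | no _

addMod-absEv : ∀ k b {s m n s'} {v : ValidEv k b (pair m n)} →
               toℕ m ≤ toℕ s → toℕ s' ≡ toℕ s ∸ toℕ m + toℕ n →
               addMod b s (absEv k b (pair m n , v)) ≡ s'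
addMod-absEv k b {s} {m} {n} {s'} {v} m≤s s'≡s∸m+n = toℕ-injective (begin
  toℕ (addMod b s (absEv k b (pair m n , v)))  ≡⟨ toℕ-fromℕ< _ ⟩
  (toℕ s + toℕ (absEv k b (pair m n , v))) % B  ≡⟨ cong (λ r → (toℕ s + r) % B) (toℕ-fromℕ< _) ⟩
  (toℕ s + (toℕ n + (B ∸ toℕ m)) % B) % B       ≡⟨ [m+n%d]%d≡[m+n]%d (toℕ s) _ B ⟩
  (toℕ s + (toℕ n + (B ∸ toℕ m))) % B           ≡⟨ m≤s⇒[s+[n+[d∸m]]]%d≡[s∸m+n]%d (toℕ n) B m≤s (<⇒≤ (toℕ<n m)) ⟩
  (toℕ s ∸ toℕ m + toℕ n) % B                   ≡⟨ cong (_% B) s'≡s∸m+n ⟨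
  toℕ s' % B                                    ≡⟨ m<n⇒m%n≡m (toℕ<n s') ⟩
  toℕ s'                                        ∎)
  where B = suc b

lemma17 : (b : ℕ) → 1 ≤ b → (k : Kind) → (A : TS) → AllReachable A →
          (sup : Fin (TS.nS A) → Fin (suc b)) →
          (sig : Fin (TS.nE A) → Eτ k b) →
          IsRegion k b A sup sig →
          IsAbstractRegion k b A sup (λ e → absEv k b (sig e))
lemma17 b _ k A _ sup sig isRegion s e s' s→s' with sig e | isRegion s e s' s→s'
... | num x , _    | fires = fires
... | pair m n , v | fires with pair-step⇒m≤s×s'≡s∸m+n k b fires
...   | m≤s , s'≡s∸m+n = cong just (addMod-absEv k b {v = v} m≤s s'≡s∸m+n)
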